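{- For every $\Gamma\cup\{\phi\}\subseteq\mathcal{L}_{\Box\Diamond}$, if $\Gamma\vdash_{\mathsf{IM_{Calc}}}\phi$ then $\Gamma\Vdash^{\mathrm{inm}}\phi$ and $\Gamma\models\phi$.
   Context: Language: fix a countable set $\mathrm{Prop}=\{p_0,p_1,\dots\}$ of proposition letters. $\mathcal{L}_{\Box\Diamond}$ is the set of formulas $\phi ::= p_i \mid \bot \mid \phi\wedge\phi \mid \phi\vee\phi \mid \phi\to\phi \mid \Box\phi \mid \Diamond\phi$; $\neg\phi$ abbreviates $\phi\to\bot$ and $\top$ abbreviates $\neg\bot$. Calculus $\mathsf{IM_{Calc}}$: let $\mathscr{Ax}$ be the set of all substitution instances of a standard axiomatisation of intuitionistic propositional logic together with all substitution instances of $(\Box p\wedge\Diamond\neg p)\to\bot$ and $(\Box\top\to\Diamond p)\to\Diamond p$. $\Gamma\vdash_{\mathsf{IM_{Calc}}}\phi$ means $\Gamma\vdash\phi$ is derivable with the rules: (El) $\Gamma\vdash\phi$ for $\phi\in\Gamma$; (Ax) $\Gamma\vdash\psi$ for $\psi\in\mathscr{Ax}$; (MP) from $\Gamma\vdash\phi$ and $\Gamma\vdash\phi\to\psi$ infer $\Gamma\vdash\psi$; (Mon$_\Box$) from $\emptyset\vdash\phi\to\psi$ infer $\Gamma\vdash\Box\phi\to\Box\psi$; (Mon$_\Diamond$) from $\emptyset\vdash\phi\to\psi$ infer $\Gamma\vdash\Diamond\phi\to\Diamond\psi$ (in the last two, $\Gamma$ arbitrary). Intuitionistic neighbourhood models: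 for a poset $(W,\le)$, an intuitionistic neighbourhood is a partial function $a:W\rightharpoonup\mathcal{P}(W)$ whose domain $\mathrm{dom}(a)$ is an upset. A model is $\mathcal{M}=(W,\le,N,V)$ with $N$ a set of intuitionistic neighbourhoods and $V$ mapping proposition letters to upsets; $N_w=\{a\in N\mid w\in\mathrm{dom}(a)\}$. Truth: $w\Vdash p$ iff $w\in V(p)$; $\bot$ never; $\wedge,\vee$ pointwise; $w\Vdash\phi\to\psi$ iff for all $v\ge w$, $v\Vdash\phi$ implies $v\Vdash\psi$; $w\Vdash\Box\phi$ iff there is $a\in N_w$ such that for all $w'\ge w$ and all $v\in a(w')$, $v\Vdash\phi$; $w\Vdash\Diamond\phi$ iff for all $w'\ge w$ and all $a\in N_{w'}$ there is $v\in a(w')$ with $v\Vdash\phi$. $\Gamma\Vdash^{\mathrm{inm}}\phi$: in every such model, every world satisfying all of $\Gamma$ satisfies $\phi$. $\mathsf{IFOM}$-structures: $\mathfrak{M}=(W,\le,\mathcal{I})$ with $(W,\le)$ a poset and, for each $w$, sets $\mathcal{I}(\mathsf{s},w),\mathcal{I}(\mathsf{n},w)$, relations $\mathcal{I}(\mathsf{N},w)\subseteq\mathcal{I}(\mathsf{s},w)\times\mathcal{I}(\mathsf{n},w)$, $\mathcal{I}(\mathsf{E},w)\subseteq\mathcal{I}(\mathsf{n},w)\times\mathcal{I}(\mathsf{s},w)$, $\mathcal{I}(P_i,w)\subseteq\mathcal{I}(\mathsf{s},w)$, all increasing along $\le$. Evaluation at $(w,x)$ with $x\in\mathcal{I}(\mathsf{s},w)$: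 $w,x\models p_i$ iff $x\in\mathcal{I}(P_i,w)$; $\bot$ never; $\wedge,\vee$ pointwise; $w,x\models\phi\to\psi$ iff for all $w'\ge w$, $w',x\models\phi$ implies $w',x\models\psi$; $w,x\models\Box\phi$ iff there is $a\in\mathcal{I}(\mathsf{n},w)$ with $(x,a)\in\mathcal{I}(\mathsf{N},w)$ such that for all $w'\ge w$, $x'\in\mathcal{I}(\mathsf{s},w')$ with $(a,x')\in\mathcal{I}(\mathsf{E},w')$, $w',x'\models\phi$; $w,x\models\Diamond\phi$ iff for all $w'\ge w$ and $a'\in\mathcal{I}(\mathsf{n},w')$ with $(x,a')\in\mathcal{I}(\mathsf{N},w')$ there is $y'\in\mathcal{I}(\mathsf{s},w')$ with $(a',y')\in\mathcal{I}(\mathsf{E},w')$ and $w',y'\models\phi$. $\Gamma\models\phi$: for all $\mathsf{IFOM}$-structures and pairs $(w,x)$, satisfying all of $\Gamma$ implies satisfying $\phi$. -}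

module Defs where

open import Data.Nat using (ℕ)
open import Data.Empty using (⊥)
open import Data.Product using (Σ; _×_)
open import Data.Sum using (_⊎_)
open import Relation.Binary.PropositionalEquality using (_≡_)
open import Relation.Binary.Structures using (IsPartialOrder)

infixr 6 _∧_
infixr 5 _∨_
infixr 4 _⇒_

data Fm : Set where
  var : ℕ → Fm
  ⊥'  : Fm
  _∧_ : Fm → Fm → Fm
  _∨_ : Fm → Fm → Fm
  _⇒_ : Fm → Fm → Fm
  □   : Fm → Fm
  ◇   : Fm → Fm

¬' : Fm → Fm
¬' φ = φ ⇒ ⊥'

⊤' : Fm
⊤' = ¬' ⊥'

FmSet : Set₁
FmSet = Fm → Set

∅ : FmSet
∅ _ = ⊥

-- Axioms: all substitution instances of a standard Hilbert axiomatisation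
-- of IPC, plus the two modal axiom schemes.

data Ax : Fm → Set where
  k     : ∀ φ ψ → Ax (φ ⇒ ψ ⇒ φ)
  s     : ∀ φ ψ χ → Ax ((φ ⇒ ψ ⇒ χ) ⇒ (φ ⇒ ψ) ⇒ φ ⇒ χ)
  ∧-e₁  : ∀ φ ψ → Ax (φ ∧ ψ ⇒ φ)
  ∧-e₂  : ∀ φ ψ → Ax (φ ∧ ψ ⇒ ψ)
  ∧-i   : ∀ φ ψ → Ax (φ ⇒ ψ ⇒ φ ∧ ψ)
  ∨-i₁  : ∀ φ ψ → Ax (φ ⇒ φ ∨ ψ)
  ∨-i₂  : ∀ φ ψ → Ax (ψ ⇒ φ ∨ ψ)
  ∨-e   : ∀ φ ψ χ → Ax ((φ ⇒ χ) ⇒ (ψ ⇒ χ) ⇒ φ ∨ ψ ⇒ χ)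
  efq   : ∀ φ → Ax (⊥' ⇒ φ)
  □◇    : ∀ φ → Ax ((□ φ ∧ ◇ (¬' φ)) ⇒ ⊥')
  ◇⊤    : ∀ φ → Ax ((□ ⊤' ⇒ ◇ φ) ⇒ ◇ φ)

infix 2 _⊢_

data _⊢_ (Γ : FmSet) : Fm → Set₁ where
  El   : ∀ {φ} → Γ φ → Γ ⊢ φ
  Axi  : ∀ {ψ} → Ax ψ → Γ ⊢ ψ
  MP   : ∀ {φ ψ} → Γ ⊢ φ → Γ ⊢ (φ ⇒ ψ) → Γ ⊢ ψ
  Mon□ : ∀ {φ ψ} → ∅ ⊢ (φ ⇒ ψ) → Γ ⊢ (□ φ ⇒ □ ψ)
  Mon◇ : ∀ {φ ψ} → ∅ ⊢ (φ ⇒ ψ) → Γ ⊢ (◇ φ ⇒ ◇ ψ)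

-- The set N of intuitionistic neighbourhoods is given as a family indexed
-- by a type Nb; each neighbourhood a has an upward-closed domain dom a and
-- a value  app a w : W → Set  (a subset of W), consulted only for w ∈ dom a.

record INM : Set₁ where
  field
    W       : Set
    _≤_     : W → W → Set
    isPO    : IsPartialOrder _≡_ _≤_
    Nb      : Set
    dom     : Nb → W → Set
    dom-up  : ∀ a {w v} → w ≤ v → dom a w → dom a v
    app     : Nb → W → W → Set
    V       : ℕ → W → Set
    V-up    : ∀ i {w v} → w ≤ v → V i w → V i v

module _ (M : INM) where
  open INM M

  infix 3 _⊩_
  _⊩_ : W → Fm → Set
  w ⊩ var i = V i w
  w ⊩ ⊥' = ⊥
  w ⊩ (φ ∧ ψ) = (w ⊩ φ) × (w ⊩ ψ)
  w ⊩ (φ ∨ ψ) = (w ⊩ φ) ⊎ (w ⊩ ψ)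
  w ⊩ (φ ⇒ ψ) = ∀ v → w ≤ v → v ⊩ φ → v ⊩ ψ
  w ⊩ □ φ = Σ Nb λ a → dom a w ×
              (∀ w' → w ≤ w' → ∀ v → app a w' v → v ⊩ φ)
  w ⊩ ◇ φ = ∀ w' → w ≤ w' → ∀ a → dom a w' →
              Σ W λ v → app a w' v × v ⊩ φ

infix 2 _⊩inm_
_⊩inm_ : FmSet → Fm → Set₁
Γ ⊩inm φ = ∀ (M : INM) (w : INM.W M) →
  (∀ ψ → Γ ψ → _⊩_ M w ψ) → _⊩_ M w φ

-- The per-world sets I(s,w), I(n,w) are given as
-- increasing predicates on global carriers S and Nn; the relations are
-- increasing predicates contained in the respective products.

record IFOM : Set₁ where
  field
    W      : Set
    _≤_    : W → W → Set
    isPO   : IsPartialOrder _≡_ _≤_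
    S      : Set
    Nn     : Set
    Is     : W → S → Set
    In     : W → Nn → Set
    IN     : W → S → Nn → Set
    IE     : W → Nn → S → Set
    IP     : ℕ → W → S → Set
    Is-up  : ∀ {w v} → w ≤ v → ∀ x → Is w x → Is v x
    In-up  : ∀ {w v} → w ≤ v → ∀ a → In w a → In v a
    IN-up  : ∀ {w v} → w ≤ v → ∀ x a → IN w x a → IN v x a
    IE-up  : ∀ {w v} → w ≤ v → ∀ a x → IE w a x → IE v a x
    IP-up  : ∀ i {w v} → w ≤ v → ∀ x → IP i w x → IP i v x
    IN-⊆   : ∀ w x a → IN w x a → Is w x × In w a
    IE-⊆   : ∀ w a x → IE w a x → In w a × Is w x
    IP-⊆   : ∀ i w x → IP i w x → Is w x

module _ (𝔐 : IFOM) where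
  open IFOM 𝔐

  -- meaningful for x ∈ I(s,w)
  sat : W → S → Fm → Set
  sat w x (var i) = IP i w x
  sat w x ⊥' = ⊥
  sat w x (φ ∧ ψ) = sat w x φ × sat w x ψ
  sat w x (φ ∨ ψ) = sat w x φ ⊎ sat w x ψ
  sat w x (φ ⇒ ψ) = ∀ w' → w ≤ w' → sat w' x φ → sat w' x ψ
  sat w x (□ φ) = Σ Nn λ a → In w a × IN w x a ×
    (∀ w' → w ≤ w' → ∀ x' → Is w' x' → IE w' a x' → sat w' x' φ)
  sat w x (◇ φ) = ∀ w' → w ≤ w' → ∀ a' → In w' a' → IN w' x a' →
    Σ S λ y' → Is w' y' × IE w' a' y' × sat w' y' φ

infix 2 _⊨_
_⊨_ : FmSet → Fm → Set₁
Γ ⊨ φ = ∀ (𝔐 : IFOM) (w : IFOM.W 𝔐) (x : IFOM.S 𝔐) → IFOM.Is 𝔐 w x →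
  (∀ ψ → Γ ψ → sat 𝔐 w x ψ) → sat 𝔐 w x φ

{-# OPTIONS --safe #-}
-- Soundness for intuitionistic neighbourhood models is the usual induction on
-- derivations, resting on persistence of truth along ≤.  Soundness for
-- IFOM-structures then comes for free: the pairs (w , x) of an IFOM-structure,
-- ordered by w ≤ w′ with x fixed, carry a neighbourhood model in which the
-- neighbourhood a is defined at (w , x) iff (x , a) ∈ I(N,w) and sends
-- (w′ , x′) to { (w′ , y) ∣ (a , y) ∈ I(E,w′) }; a pair forces φ there iff
-- it satisfies φ in the structure.
module Submission where

open import Defs
open import Data.Product using (_×_; _,_; proj₂)
open import Data.Product.Properties using (×-≡,≡→≡)
open import Data.Sum using (inj₁; inj₂)
open import Function.Base using (case_of_)
open import Function.Bundles using (_⇔_; mk⇔; Equivalence)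
open import Relation.Binary.PropositionalEquality using (_≡_; refl; isEquivalence)
open import Relation.Binary.Structures using (IsPartialOrder)

open Equivalence using (to; from)

module INM-Soundness (M : INM) where
  open INM M
  open IsPartialOrder isPO using () renaming (refl to ≤-refl; trans to ≤-trans)

  infix 3 _⊩ᴹ_
  _⊩ᴹ_ : W → Fm → Set
  _⊩ᴹ_ = _⊩_ M

  ⊩-mono : ∀ φ {w v} → w ≤ v → w ⊩ᴹ φ → v ⊩ᴹ φ
  ⊩-mono (var i) w≤v p = V-up i w≤v p
  ⊩-mono (φ ∧ ψ) w≤v (p , q) = ⊩-mono φ w≤v p , ⊩-mono ψ w≤v q
  ⊩-mono (φ ∨ ψ) w≤v (inj₁ p) = inj₁ (⊩-mono φ w≤v p)
  ⊩-mono (φ ∨ ψ) w≤v (inj₂ q) = inj₂ (⊩-mono ψ w≤v q)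
  ⊩-mono (φ ⇒ ψ) w≤v f u v≤u = f u (≤-trans w≤v v≤u)
  ⊩-mono (□ φ) w≤v (a , a∈N , all) =
    a , dom-up a w≤v a∈N , λ w′ v≤w′ → all w′ (≤-trans w≤v v≤w′)
  ⊩-mono (◇ φ) w≤v some w′ v≤w′ = some w′ (≤-trans w≤v v≤w′)

  Ax-valid : ∀ {φ} → Ax φ → ∀ w → w ⊩ᴹ φ
  Ax-valid (k φ ψ) _ v _ p u v≤u _ = ⊩-mono φ v≤u p
  Ax-valid (s φ ψ χ) _ _ _ f u v≤u g t u≤t p =
    f t (≤-trans v≤u u≤t) p t ≤-refl (g t u≤t p)
  Ax-valid (∧-e₁ φ ψ) _ _ _ (p , _) = p
  Ax-valid (∧-e₂ φ ψ) _ _ _ (_ , q) = q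
  Ax-valid (∧-i φ ψ) _ _ _ p u v≤u q = ⊩-mono φ v≤u p , q
  Ax-valid (∨-i₁ φ ψ) _ _ _ = inj₁
  Ax-valid (∨-i₂ φ ψ) _ _ _ = inj₂
  Ax-valid (∨-e φ ψ χ) _ _ _ f u v≤u g t u≤t (inj₁ p) = f t (≤-trans v≤u u≤t) p
  Ax-valid (∨-e φ ψ χ) _ _ _ f u v≤u g t u≤t (inj₂ q) = g t u≤t q
  Ax-valid (efq φ) _ _ _ ()
  Ax-valid (□◇ φ) _ v _ ((a , a∈N , all) , some) =
    let (x , x∈a , ¬p) = some v ≤-refl a a∈N
    in ¬p x ≤-refl (all v ≤-refl x x∈a)
  -- The neighbourhood a itself witnesses □⊤, since ⊤ holds everywhere.
  Ax-valid (◇⊤ φ) _ _ _ f w′ v≤w′ a a∈N =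
    f w′ v≤w′ (a , a∈N , λ _ _ _ _ _ _ ()) w′ ≤-refl a a∈N

  valid-⇒ : ∀ {φ ψ} → ∅ ⊢ φ ⇒ ψ → ∀ {w} → w ⊩ᴹ φ → w ⊩ᴹ ψ

  ⊢-sound : ∀ {Γ φ} → Γ ⊢ φ → ∀ w → (∀ ψ → Γ ψ → w ⊩ᴹ ψ) → w ⊩ᴹ φ
  ⊢-sound (El {φ} φ∈Γ) _ Γ-holds = Γ-holds φ φ∈Γ
  ⊢-sound (Axi ax) w _ = Ax-valid ax w
  ⊢-sound (MP d e) w Γ-holds = ⊢-sound e w Γ-holds w ≤-refl (⊢-sound d w Γ-holds)
  ⊢-sound (Mon□ d) _ _ _ _ (a , a∈N , all) =
    a , a∈N , λ w′ v≤w′ u u∈a → valid-⇒ d (all w′ v≤w′ u u∈a)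
  ⊢-sound (Mon◇ d) _ _ _ _ some w′ v≤w′ a a∈N =
    let (u , u∈a , p) = some w′ v≤w′ a a∈N in u , u∈a , valid-⇒ d p

  valid-⇒ d {w} p = ⊢-sound d w (λ _ ()) w ≤-refl p

⊢⇒⊩inm : ∀ {Γ φ} → Γ ⊢ φ → Γ ⊩inm φ
⊢⇒⊩inm d M = INM-Soundness.⊢-sound M d

module PairModel (𝔐 : IFOM) where
  open IFOM 𝔐
  open IsPartialOrder isPO using ()
    renaming (refl to ≤-refl; trans to ≤-trans; antisym to ≤-antisym)

  Pair : Set
  Pair = W × S

  _≤ᴾ_ : Pair → Pair → Set
  (w , x) ≤ᴾ (w′ , x′) = w ≤ w′ × x ≡ x′

  ≤ᴾ-isPartialOrder : IsPartialOrder _≡_ _≤ᴾ_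
  ≤ᴾ-isPartialOrder = record
    { isPreorder = record
      { isEquivalence = isEquivalence
      ; reflexive     = λ { refl → ≤-refl , refl }
      ; trans         = λ { (w≤v , refl) (v≤u , refl) → ≤-trans w≤v v≤u , refl }
      }
    ; antisym = λ { (w≤v , refl) (v≤w , _) → ×-≡,≡→≡ (≤-antisym w≤v v≤w , refl) }
    }

  pairModel : INM
  pairModel = record
    { W      = Pair
    ; _≤_    = _≤ᴾ_
    ; isPO   = ≤ᴾ-isPartialOrder
    ; Nb     = Nn
    ; dom    = λ a (w , x) → IN w x a
    ; dom-up = λ { a {w , x} (w≤v , refl) → IN-up w≤v x a }
    ; app    = λ a (w′ , _) (v , y) → v ≡ w′ × IE w′ a y
    ; V      = λ i (w , x) → IP i w x
    ; V-up   = λ { i {w , x} (w≤v , refl) → IP-up i w≤v x }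
    }

  sat⇔⊩ : ∀ φ w x → sat 𝔐 w x φ ⇔ _⊩_ pairModel (w , x) φ
  sat⇔⊩ (var i) w x = mk⇔ (λ p → p) (λ p → p)
  sat⇔⊩ ⊥' w x = mk⇔ (λ ()) (λ ())
  sat⇔⊩ (φ ∧ ψ) w x = mk⇔
    (λ (p , q) → to (sat⇔⊩ φ w x) p , to (sat⇔⊩ ψ w x) q)
    (λ (p , q) → from (sat⇔⊩ φ w x) p , from (sat⇔⊩ ψ w x) q)
  sat⇔⊩ (φ ∨ ψ) w x = mk⇔
    (λ { (inj₁ p) → inj₁ (to (sat⇔⊩ φ w x) p)
       ; (inj₂ q) → inj₂ (to (sat⇔⊩ ψ w x) q) })
    (λ { (inj₁ p) → inj₁ (from (sat⇔⊩ φ w x) p)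
       ; (inj₂ q) → inj₂ (from (sat⇔⊩ ψ w x) q) })
  sat⇔⊩ (φ ⇒ ψ) w x = mk⇔
    (λ { f (w′ , _) (w≤w′ , refl) p →
         to (sat⇔⊩ ψ w′ x) (f w′ w≤w′ (from (sat⇔⊩ φ w′ x) p)) })
    (λ f w′ w≤w′ p →
       from (sat⇔⊩ ψ w′ x) (f (w′ , x) (w≤w′ , refl) (to (sat⇔⊩ φ w′ x) p)))
  sat⇔⊩ (□ φ) w x = mk⇔
    (λ { (a , _ , xNa , all) →
         a , xNa , λ { (w′ , _) (w≤w′ , refl) (_ , y) (refl , aEy) →
         to (sat⇔⊩ φ w′ y) (all w′ w≤w′ y (proj₂ (IE-⊆ w′ a y aEy)) aEy) } })
    (λ (a , xNa , all) → a , proj₂ (IN-⊆ w x a xNa) , xNa , λ w′ w≤w′ y _ aEy →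
         from (sat⇔⊩ φ w′ y) (all (w′ , x) (w≤w′ , refl) (w′ , y) (refl , aEy)))
  sat⇔⊩ (◇ φ) w x = mk⇔
    (λ { some (w′ , _) (w≤w′ , refl) a xNa →
         let (y , _ , aEy , p) = some w′ w≤w′ a (proj₂ (IN-⊆ w′ x a xNa)) xNa
         in (w′ , y) , (refl , aEy) , to (sat⇔⊩ φ w′ y) p })
    (λ some w′ w≤w′ a _ xNa → case some (w′ , x) (w≤w′ , refl) a xNa of λ
       { ((_ , y) , (refl , aEy) , p) →
           y , proj₂ (IE-⊆ w′ a y aEy) , aEy , from (sat⇔⊩ φ w′ y) p })

⊩inm⇒⊨ : ∀ {Γ φ} → Γ ⊩inm φ → Γ ⊨ φ
⊩inm⇒⊨ {Γ} {φ} valid 𝔐 w x _ Γ-holds =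
  from (sat⇔⊩ φ w x)
    (valid pairModel (w , x) λ ψ ψ∈Γ → to (sat⇔⊩ ψ w x) (Γ-holds ψ ψ∈Γ))
  where open PairModel 𝔐

theorem3p9 : (Γ : FmSet) (φ : Fm) → Γ ⊢ φ → (Γ ⊩inm φ) × (Γ ⊨ φ)
theorem3p9 Γ φ d = ⊢⇒⊩inm d , ⊩inm⇒⊨ {Γ} {φ} (⊢⇒⊩inm d)
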